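{- Let $k$ be even and let $n>k$ be a positive integer with $n\equiv k/2 \pmod{k}$. Then $\mathrm{msum}(n,k)=1$. Moreover, if $n$ is odd, then also $\mathrm{disc}(n,k)=1$.
   Context: $S_n$ denotes the set of permutations $\pi=(\pi_1,\ldots,\pi_n)$ of $1,\ldots,n$, with indices taken cyclically: $\pi_{n+i}=\pi_i$. For $\pi\in S_n$ let $s_i=\sum_{j=0}^{k-1}\pi_{i+j}$ for $i=1,\ldots,n$. Define $\mathrm{msum}(\pi,k)=\max\{s_i: 1\le i\le n\}-\frac{k(n+1)}{2}$, $\mathrm{msum}(n,k)=\min\{\mathrm{msum}(\pi,k):\pi\in S_n\}$, $\mathrm{disc}(\pi,k)=\max\{|s_i-\frac{k(n+1)}{2}|: 1\le i\le n\}$ and $\mathrm{disc}(n,k)=\min\{\mathrm{disc}(\pi,k):\pi\in S_n\}$. -}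

module Defs where

open import Data.Nat using (ℕ; zero; suc; _+_; _*_; _⊔_; NonZero)
open import Data.Nat.DivMod using (_%_)
open import Data.Fin using (Fin; toℕ; fromℕ<)
open import Data.Fin.Permutation using (Permutation′; _⟨$⟩ʳ_)
open import Data.List using (List; foldr; map; upTo; allFin)
open import Data.Nat.ListAction using (sum)
open import Data.Nat.DivMod using (m%n<n)
open import Data.Integer using (+_)
import Data.Rational as ℚ
open ℚ using (ℚ)

-- A permutation π ∈ S_n is a bijection σ : Fin n → Fin n, with
-- π_i = 1 + toℕ (σ (i-1))  (positions and values shifted by one).

πval : {n : ℕ} .{{_ : NonZero n}} → Permutation′ n → ℕ → ℕ
πval {n} σ p = suc (toℕ (σ ⟨$⟩ʳ fromℕ< (m%n<n p n)))

-- window sum s_i = π_i + ... + π_{i+k-1}, for 0-based start position i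
window : {n : ℕ} .{{_ : NonZero n}} → Permutation′ n → ℕ → Fin n → ℕ
window σ k i = sum (map (λ j → πval σ (toℕ i + j)) (upTo k))

-- max { s_i : 1 ≤ i ≤ n }  (all s_i ≥ 0 and n ≥ 1, so 0 is a safe seed)
maxWindow : {n : ℕ} .{{_ : NonZero n}} → Permutation′ n → ℕ → ℕ
maxWindow {n} σ k = foldr _⊔_ 0 (map (window σ k) (allFin n))

centre : ℕ → ℕ → ℚ
centre n k = (+ (k * (n + 1))) ℚ./ 2

msumπ : {n : ℕ} .{{_ : NonZero n}} → Permutation′ n → ℕ → ℚ
msumπ {n} σ k = (+ maxWindow σ k) ℚ./ 1 ℚ.- centre n k

-- disc(π,k) = max_i | s_i − k(n+1)/2 |  (values ≥ 0, so 0 is a safe seed)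
discπ : {n : ℕ} .{{_ : NonZero n}} → Permutation′ n → ℕ → ℚ
discπ {n} σ k =
  foldr ℚ._⊔_ ℚ.0ℚ (map (λ i → ℚ.∣ (+ window σ k i) ℚ./ 1 ℚ.- centre n k ∣) (allFin n))

MsumEq : (n : ℕ) .{{_ : NonZero n}} → ℕ → ℚ → Set
MsumEq n k v = (Data.Product.Σ (Permutation′ n) λ σ → msumπ σ k Relation.Binary.PropositionalEquality.≡ v)
  Data.Product.× ((σ : Permutation′ n) → v ℚ.≤ msumπ σ k)
  where import Data.Product
        import Relation.Binary.PropositionalEquality

DiscEq : (n : ℕ) .{{_ : NonZero n}} → ℕ → ℚ → Set
DiscEq n k v = (Data.Product.Σ (Permutation′ n) λ σ → discπ σ k Relation.Binary.PropositionalEquality.≡ v)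
  Data.Product.× ((σ : Permutation′ n) → v ℚ.≤ discπ σ k)
  where import Data.Product
        import Relation.Binary.PropositionalEquality

module Submission where

open import Defs
open import Data.Nat using (ℕ; _<_; _/_; NonZero)
open import Data.Nat.DivMod using (_%_)
open import Data.Nat.Divisibility using (_∣_)
open import Data.Product using (_×_)
open import Relation.Nullary using (¬_)
open import Relation.Binary.PropositionalEquality using (_≡_)
open import Data.Rational using (1ℚ)

-- Write k = 2m.  The hypothesis says n = N·m with N = 2q+1 odd, and the centre k(n+1)/2
-- is the integer c = m(n+1).
-- * Lower bound, for every π and every 0 < k < n: the n cyclic windows of length k sum
--   to k·n(n+1)/2 = n·c.  If none exceeded c they would all equal c, and s_1 = s_2 would
--   force π_1 = π_{k+1}.  So some s_i ≥ c+1, giving msum(π,k) ≥ 1 and disc(π,k) ≥ 1.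
-- * Upper bound, by explicit permutations, built from inverse pairs of maps on
--   {0, …, n−1} by permuting the columns of a grid and reading it column by column.
--   For even m the positions 2j, 2j+1 carry x+1 and n−x, so windows at even positions sum
--   to c and the others to at most c+1 (msum ≤ 1).  For odd m the entries m apart sum to
--   N(2s+1) plus an excess in {0,1,2}; the excesses telescope against a potential in
--   {0,1}, so every window sum lies in [c−1, c+1] (disc ≤ 1).

open import Data.Nat
open import Data.Nat.Properties
open import Data.Nat.DivMod
open import Data.Nat.Divisibility using (divides; divides-refl)
open import Data.Nat.ListAction using (sum)
open import Data.Nat.Tactic.RingSolver using (solve-∀)
open import Algebra.Properties.CommutativeSemigroup +-commutativeSemigroup using (interchange; x∙yz≈y∙xz; xy∙z≈xz∙y)
import Algebra.Properties.CommutativeMonoid.Sum as CommutativeMonoidSum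
open import Data.Parity.Base as ℙ using (Parity; 0ℙ; 1ℙ; _⁻¹)
import Data.Parity.Properties as ℙₚ
open import Data.Integer as ℤ using (ℤ; _⊖_; +≤+)
import Data.Integer.Properties as ℤₚ
open import Data.Rational as ℚ using (ℚ; mkℚ; 0ℚ)
import Data.Rational.Properties as ℚₚ
open import Data.Rational.Unnormalised using (mkℚᵘ; *≡*)
import Data.Nat.Coprimality as Coprimality
open import Data.Fin using (Fin; toℕ; fromℕ<)
import Data.Fin.Properties as Finₚ
open import Data.Fin.Permutation using (Permutation′; permutation; _⟨$⟩ʳ_; _⟨$⟩ˡ_; inverseˡ)
open import Data.List using (List; []; _∷_; foldr; map; applyUpTo; allFin)
open import Data.List.Membership.Propositional using (_∈_)
open import Data.List.Membership.Propositional.Properties using (∈-allFin)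
open import Data.List.Relation.Unary.Any using (here; there)
open import Data.Product using (∃; _,_)
open import Data.Sum using (inj₁; inj₂)
open import Data.Empty using (⊥-elim)
open import Function using (_∘_; id)
open import Relation.Binary.PropositionalEquality
open import Relation.Nullary using (yes; no; contradiction)

module FinSum = CommutativeMonoidSum +-0-commutativeMonoid

sumTo : (ℕ → ℕ) → ℕ → ℕ
sumTo f zero = 0
sumTo f (suc l) = sumTo f l + f l

sumTo-cong : ∀ {f g} l → (∀ j → j < l → f j ≡ g j) → sumTo f l ≡ sumTo g l
sumTo-cong zero eq = refl
sumTo-cong (suc l) eq = cong₂ _+_ (sumTo-cong l (λ j j<l → eq j (m<n⇒m<1+n j<l))) (eq l ≤-refl)

sumTo-+ : ∀ f g l → sumTo (λ j → f j + g j) l ≡ sumTo f l + sumTo g l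
sumTo-+ f g zero = refl
sumTo-+ f g (suc l) = trans (cong (_+ (f l + g l)) (sumTo-+ f g l)) (interchange (sumTo f l) (sumTo g l) (f l) (g l))

sumTo-*ˡ : ∀ c f l → sumTo (λ j → c * f j) l ≡ c * sumTo f l
sumTo-*ˡ c f zero = sym (*-zeroʳ c)
sumTo-*ˡ c f (suc l) = trans (cong (_+ c * f l) (sumTo-*ˡ c f l)) (sym (*-distribˡ-+ c (sumTo f l) (f l)))

sumTo-const : ∀ c l → sumTo (λ _ → c) l ≡ l * c
sumTo-const c zero = refl
sumTo-const c (suc l) = trans (cong (_+ c) (sumTo-const c l)) (+-comm (l * c) c)

sumTo-split : ∀ f a b → sumTo f (a + b) ≡ sumTo f a + sumTo (λ j → f (a + j)) b
sumTo-split f a zero = trans (cong (sumTo f) (+-identityʳ a)) (sym (+-identityʳ _))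
sumTo-split f a (suc b) = begin
  sumTo f (a + suc b)                                 ≡⟨ cong (sumTo f) (+-suc a b) ⟩
  sumTo f (a + b) + f (a + b)                         ≡⟨ cong (_+ f (a + b)) (sumTo-split f a b) ⟩
  sumTo f a + sumTo (λ j → f (a + j)) b + f (a + b)   ≡⟨ +-assoc (sumTo f a) _ _ ⟩
  sumTo f a + sumTo (λ j → f (a + j)) (suc b)         ∎
  where open ≡-Reasoning

sumTo-front : ∀ f l → sumTo f (suc l) ≡ f 0 + sumTo (f ∘ suc) l
sumTo-front f l = sumTo-split f 1 l

sumTo-periodic : ∀ h l → (∀ x → h (x + l) ≡ h x) → ∀ a → sumTo (λ j → h (a + j)) l ≡ sumTo h l
sumTo-periodic h l per zero = refl
sumTo-periodic h l per (suc a) = trans (+-cancelˡ-≡ (g 0) _ _ shift) (sumTo-periodic h l per a)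
  where
  open ≡-Reasoning
  g : ℕ → ℕ
  g j = h (a + j)
  shift : g 0 + sumTo (λ j → h (suc a + j)) l ≡ g 0 + sumTo g l
  shift = begin
    g 0 + sumTo (λ j → h (suc a + j)) l ≡⟨ cong (g 0 +_) (sumTo-cong l (λ j _ → cong h (sym (+-suc a j)))) ⟩
    g 0 + sumTo (g ∘ suc) l             ≡⟨ sumTo-front g l ⟨
    sumTo g l + h (a + l)               ≡⟨ cong (sumTo g l +_) (trans (per a) (cong h (sym (+-identityʳ a)))) ⟩
    sumTo g l + g 0                     ≡⟨ +-comm (sumTo g l) (g 0) ⟩
    g 0 + sumTo g l                     ∎

sumTo-telescope : ∀ (a δ : ℕ → ℕ) c → (∀ z → a z + δ (suc z) ≡ c + δ z) →
                  ∀ p l → sumTo (λ j → a (p + j)) l + δ (p + l) ≡ l * c + δ p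
sumTo-telescope a δ c local p zero = cong δ (+-identityʳ p)
sumTo-telescope a δ c local p (suc l) = begin
  S + a (p + l) + δ (p + suc l)   ≡⟨ cong (λ x → S + a (p + l) + δ x) (+-suc p l) ⟩
  S + a (p + l) + δ (suc (p + l)) ≡⟨ +-assoc S _ _ ⟩
  S + (a (p + l) + δ (suc (p + l))) ≡⟨ cong (S +_) (local (p + l)) ⟩
  S + (c + δ (p + l))             ≡⟨ x∙yz≈y∙xz S c _ ⟩
  c + (S + δ (p + l))             ≡⟨ cong (c +_) (sumTo-telescope a δ c local p l) ⟩
  c + (l * c + δ p)               ≡⟨ +-assoc c (l * c) (δ p) ⟨
  suc l * c + δ p                 ∎
  where
  open ≡-Reasoning
  S : ℕ
  S = sumTo (λ j → a (p + j)) l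

sumTo-pairs : ∀ f t → sumTo f (t * 2) ≡ sumTo (λ u → f (u * 2) + f (suc (u * 2))) t
sumTo-pairs f zero = refl
sumTo-pairs f (suc t) = begin
  sumTo f (suc (suc (t * 2)))                              ≡⟨ +-assoc (sumTo f (t * 2)) _ _ ⟩
  sumTo f (t * 2) + (f (t * 2) + f (suc (t * 2)))          ≡⟨ cong (_+ (f (t * 2) + f (suc (t * 2)))) (sumTo-pairs f t) ⟩
  sumTo (λ u → f (u * 2) + f (suc (u * 2))) (suc t)        ∎
  where open ≡-Reasoning

sumTo-suc : ∀ l → sumTo suc l * 2 ≡ l * suc l
sumTo-suc zero = refl
sumTo-suc (suc l) = begin
  (sumTo suc l + suc l) * 2 ≡⟨ *-distribʳ-+ 2 (sumTo suc l) (suc l) ⟩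
  sumTo suc l * 2 + suc l * 2 ≡⟨ cong (_+ suc l * 2) (trans (sumTo-suc l) (*-comm l (suc l))) ⟩
  suc l * l + suc l * 2 ≡⟨ *-distribˡ-+ (suc l) l 2 ⟨
  suc l * (l + 2) ≡⟨ cong (suc l *_) (+-comm l 2) ⟩
  suc l * suc (suc l) ∎
  where open ≡-Reasoning

sumTo-odd : ∀ l → sumTo (λ j → suc (j * 2)) l ≡ l * l
sumTo-odd zero = refl
sumTo-odd (suc l) = begin
  sumTo (λ j → suc (j * 2)) l + suc (l * 2) ≡⟨ cong (_+ suc (l * 2)) (sumTo-odd l) ⟩
  l * l + suc (l * 2) ≡⟨ +-suc (l * l) (l * 2) ⟩
  suc (l * l + l * 2) ≡⟨ cong suc (*-distribˡ-+ l l 2) ⟨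
  suc (l * (l + 2)) ≡⟨ cong (λ x → suc (l * x)) (+-comm l 2) ⟩
  suc (l * suc (suc l)) ≡⟨ cong suc (*-suc l (suc l)) ⟩
  suc (l + l * suc l) ≡⟨⟩
  suc l * suc l ∎
  where open ≡-Reasoning

sumTo-≤ : ∀ h c l → (∀ p → p < l → h p ≤ c) → sumTo h l ≤ l * c
sumTo-≤ h c zero bound = z≤n
sumTo-≤ h c (suc l) bound = subst (sumTo h l + h l ≤_) (+-comm (l * c) c)
  (+-mono-≤ (sumTo-≤ h c l (λ p p<l → bound p (m<n⇒m<1+n p<l))) (bound l ≤-refl))

sumTo-< : ∀ h c l → (∀ p → p < l → h p ≤ c) → ∀ j → j < l → h j < c → sumTo h l < l * c
sumTo-< h c (suc l) bound j j<1+l hj<c with j ≟ l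
... | yes refl = subst (sumTo h l + h l <_) (+-comm (l * c) c)
  (+-mono-≤-< (sumTo-≤ h c l (λ p p<l → bound p (m<n⇒m<1+n p<l))) hj<c)
... | no j≢l = subst (sumTo h l + h l <_) (+-comm (l * c) c)
  (+-mono-<-≤ (sumTo-< h c l (λ p p<l → bound p (m<n⇒m<1+n p<l)) j (≤∧≢⇒< (s≤s⁻¹ j<1+l) j≢l) hj<c) (bound l ≤-refl))

sumTo-tight : ∀ h c l → (∀ p → p < l → h p ≤ c) → sumTo h l ≡ l * c → ∀ p → p < l → h p ≡ c
sumTo-tight h c l bound total p p<l with h p <? c
... | yes hp<c = contradiction total (<⇒≢ (sumTo-< h c l bound p p<l hp<c))
... | no hp≮c = ≤-antisym (bound p p<l) (≮⇒≥ hp≮c)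

-- The window sums of Defs are list sums over upTo k = applyUpTo id k; they are sumTo's.
sum-applyUpTo : ∀ (f g : ℕ → ℕ) l → sum (map f (applyUpTo g l)) ≡ sumTo (f ∘ g) l
sum-applyUpTo f g zero = refl
sum-applyUpTo f g (suc l) = begin
  f (g 0) + sum (map f (applyUpTo (g ∘ suc) l)) ≡⟨ cong (f (g 0) +_) (sum-applyUpTo f (g ∘ suc) l) ⟩
  f (g 0) + sumTo (f ∘ g ∘ suc) l              ≡⟨ sym (sumTo-front (f ∘ g) l) ⟩
  sumTo (f ∘ g) (suc l)                         ∎
  where open ≡-Reasoning

maxOver : ∀ {A : Set} → (A → ℕ) → List A → ℕ
maxOver g xs = foldr _⊔_ 0 (map g xs)

maxOver-ub : ∀ {A : Set} (g : A → ℕ) xs {x} → x ∈ xs → g x ≤ maxOver g xs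
maxOver-ub g (y ∷ xs) (here refl) = m≤m⊔n (g y) _
maxOver-ub g (y ∷ xs) (there x∈xs) = ≤-trans (maxOver-ub g xs x∈xs) (m≤n⊔m (g y) _)

maxOver-lub : ∀ {A : Set} (g : A → ℕ) xs {b} → (∀ x → g x ≤ b) → maxOver g xs ≤ b
maxOver-lub g [] bound = z≤n
maxOver-lub g (y ∷ xs) bound = ⊔-lub (bound y) (maxOver-lub g xs bound)

data EvenOdd : ℕ → Set where
  twice : ∀ j → EvenOdd (j * 2)
  twice+1 : ∀ j → EvenOdd (suc (j * 2))

evenOdd : ∀ x → EvenOdd x
evenOdd zero = twice 0
evenOdd (suc x) with evenOdd x
... | twice j = twice+1 j
... | twice+1 j = twice (suc j)

module Windows {n : ℕ} .{{_ : NonZero n}} (σ : Permutation′ n) where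

  P : ℕ → ℕ
  P = πval σ

  W : ℕ → ℕ → ℕ
  W a l = sumTo (λ j → P (a + j)) l

  window≡W : ∀ k i → window σ k i ≡ W (toℕ i) k
  window≡W k i = sum-applyUpTo (λ j → P (toℕ i + j)) id k

  P-mod : ∀ x → P (x % n) ≡ P x
  P-mod x = cong (λ i → suc (toℕ (σ ⟨$⟩ʳ i))) (Finₚ.toℕ-injective
    (trans (Finₚ.toℕ-fromℕ< _) (trans (m%n%n≡m%n x n) (sym (Finₚ.toℕ-fromℕ< _)))))

  P-+kn : ∀ x a → P (x + a * n) ≡ P x
  P-+kn x a = trans (sym (P-mod (x + a * n))) (trans (cong P ([m+kn]%n≡m%n x a n)) (P-mod x))

  P-periodic : ∀ x → P (x + n) ≡ P x
  P-periodic x = trans (cong (λ y → P (x + y)) (sym (*-identityˡ n))) (P-+kn x 1)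

  P-toℕ : ∀ (i : Fin n) → P (toℕ i) ≡ suc (toℕ (σ ⟨$⟩ʳ i))
  P-toℕ i = cong (λ i → suc (toℕ (σ ⟨$⟩ʳ i))) (Finₚ.toℕ-injective
    (trans (Finₚ.toℕ-fromℕ< _) (m<n⇒m%n≡m (Finₚ.toℕ<n i))))

  P-injective : ∀ {a b} → a < n → b < n → P a ≡ P b → a ≡ b
  P-injective {a} {b} a<n b<n Pa≡Pb = begin
    a                  ≡⟨ Finₚ.toℕ-fromℕ< a<n ⟨
    toℕ (fromℕ< a<n)   ≡⟨ cong toℕ (σ-injective (Finₚ.toℕ-injective σ-eq)) ⟩
    toℕ (fromℕ< b<n)   ≡⟨ Finₚ.toℕ-fromℕ< b<n ⟩
    b                  ∎
    where
    open ≡-Reasoning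
    σ-injective : ∀ {x y} → σ ⟨$⟩ʳ x ≡ σ ⟨$⟩ʳ y → x ≡ y
    σ-injective e = trans (sym (inverseˡ σ)) (trans (cong (σ ⟨$⟩ˡ_) e) (inverseˡ σ))
    σ-eq : toℕ (σ ⟨$⟩ʳ fromℕ< a<n) ≡ toℕ (σ ⟨$⟩ʳ fromℕ< b<n)
    σ-eq = suc-injective (trans (sym (P-toℕ (fromℕ< a<n)))
      (trans (cong P (Finₚ.toℕ-fromℕ< a<n)) (trans Pa≡Pb (trans (cong P (sym (Finₚ.toℕ-fromℕ< b<n))) (P-toℕ (fromℕ< b<n))))))

  W-slide : ∀ a l → W (suc a) l + P a ≡ W a l + P (a + l)
  W-slide a l = begin
    W (suc a) l + P a                        ≡⟨ +-comm (W (suc a) l) (P a) ⟩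
    P a + W (suc a) l                        ≡⟨ cong₂ _+_ (cong P (sym (+-identityʳ a))) (sumTo-cong l (λ j _ → cong P (sym (+-suc a j)))) ⟩
    P (a + 0) + sumTo (λ j → P (a + suc j)) l ≡⟨ sumTo-front (λ j → P (a + j)) l ⟨
    W a (suc l)                              ∎
    where open ≡-Reasoning

  -- One period of π contains each of 1, …, n once.
  P-total : sumTo P n * 2 ≡ n * suc n
  P-total = trans (cong (_* 2) values) (sumTo-suc n)
    where
    open ≡-Reasoning
    sumTo≡FinSum : ∀ (h : ℕ → ℕ) l → sumTo h l ≡ FinSum.sum {l} (h ∘ toℕ)
    sumTo≡FinSum h zero = refl
    sumTo≡FinSum h (suc l) = trans (sumTo-front h l) (cong (h 0 +_) (sumTo≡FinSum (h ∘ suc) l))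
    values : sumTo P n ≡ sumTo suc n
    values = begin
      sumTo P n                                  ≡⟨ sumTo≡FinSum P n ⟩
      FinSum.sum {n} (P ∘ toℕ)                   ≡⟨ FinSum.sum-cong-≗ {n} P-toℕ ⟩
      FinSum.sum {n} (λ i → suc (toℕ (σ ⟨$⟩ʳ i))) ≡⟨ FinSum.sum-permute {n} {n} (suc ∘ toℕ) σ ⟨
      FinSum.sum {n} (suc ∘ toℕ)                 ≡⟨ sumTo≡FinSum suc n ⟨
      sumTo suc n                                ∎

  -- Every entry of π lies in exactly k of the n windows of length k.
  W-total : ∀ k → sumTo (λ a → W a k) n ≡ k * sumTo P n
  W-total zero = trans (sumTo-const 0 n) (*-zeroʳ n)
  W-total (suc k) = begin
    sumTo (λ a → W a k + P (a + k)) n            ≡⟨ sumTo-+ (λ a → W a k) (λ a → P (a + k)) n ⟩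
    sumTo (λ a → W a k) n + sumTo (λ a → P (a + k)) n ≡⟨ cong₂ _+_ (W-total k) shifted ⟩
    k * sumTo P n + sumTo P n                    ≡⟨ +-comm (k * sumTo P n) _ ⟩
    suc k * sumTo P n                            ∎
    where
    open ≡-Reasoning
    shifted : sumTo (λ a → P (a + k)) n ≡ sumTo P n
    shifted = trans (sumTo-cong n (λ a _ → cong P (+-comm a k))) (sumTo-periodic P n P-periodic k)

  W-average : ∀ k c → k * suc n ≡ c * 2 → sumTo (λ a → W a k) n ≡ n * c
  W-average k c k[n+1]≡2c = *-cancelʳ-≡ _ _ 2 (begin
    sumTo (λ a → W a k) n * 2 ≡⟨ cong (_* 2) (W-total k) ⟩
    k * sumTo P n * 2         ≡⟨ *-assoc k (sumTo P n) 2 ⟩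
    k * (sumTo P n * 2)       ≡⟨ cong (k *_) P-total ⟩
    k * (n * suc n)           ≡⟨ x*[y*z]≡y*[x*z] k n (suc n) ⟩
    n * (k * suc n)           ≡⟨ cong (n *_) k[n+1]≡2c ⟩
    n * (c * 2)               ≡⟨ *-assoc n c 2 ⟨
    n * c * 2                 ∎)
    where
    open ≡-Reasoning
    open import Algebra.Properties.CommutativeSemigroup *-commutativeSemigroup using () renaming (x∙yz≈y∙xz to x*[y*z]≡y*[x*z])

  -- Lower bound: for 0 < k < n some window exceeds the average, since otherwise all
  -- windows would equal c, and W 0 k = W 1 k would force π_0 = π_k.
  some-window-exceeds : ∀ k c → 0 < k → k < n → k * suc n ≡ c * 2 → ∃ λ (i : Fin n) → c < window σ k i
  some-window-exceeds k c 0<k k<n k[n+1]≡2c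
    with Finₚ.¬∀⟶∃¬ n (λ i → window σ k i ≤ c) (λ i → window σ k i ≤? c) all-small-impossible
    where
    all-small-impossible : ¬ (∀ i → window σ k i ≤ c)
    all-small-impossible all-small = <⇒≢ 0<k (P-injective 0<n k<n P0≡Pk)
      where
      0<n : 0 < n
      0<n = <-trans 0<k k<n
      small : ∀ a → a < n → W a k ≤ c
      small a a<n = subst (_≤ c) (trans (window≡W k (fromℕ< a<n)) (cong (λ x → W x k) (Finₚ.toℕ-fromℕ< a<n))) (all-small (fromℕ< a<n))
      exact : ∀ a → a < n → W a k ≡ c
      exact = sumTo-tight (λ a → W a k) c n small (W-average k c k[n+1]≡2c)
      P0≡Pk : P 0 ≡ P k
      P0≡Pk = +-cancelˡ-≡ c _ _ (begin
        c + P 0       ≡⟨ cong (_+ P 0) (exact 1 (≤-trans (s≤s 0<k) k<n)) ⟨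
        W 1 k + P 0   ≡⟨ W-slide 0 k ⟩
        W 0 k + P k   ≡⟨ cong (_+ P k) (exact 0 0<n) ⟩
        c + P k       ∎)
        where open ≡-Reasoning
  ... | i , not-small = i , ≰⇒> not-small

⟦_⟧ : ℤ → ℚ
⟦ i ⟧ = mkℚ i 0 (Coprimality.sym (Coprimality.1-coprimeTo _))

/1≡⟦⟧ : ∀ i → i ℚ./ 1 ≡ ⟦ i ⟧
/1≡⟦⟧ i = ℚₚ.↥p/↧p≡p ⟦ i ⟧

⟦⟧-+ : ∀ a b → ⟦ a ⟧ ℚ.+ ⟦ b ⟧ ≡ ⟦ a ℤ.+ b ⟧
⟦⟧-+ a b = trans (cong₂ (λ x y → (x ℤ.+ y) ℚ./ 1) (ℤₚ.*-identityʳ a) (ℤₚ.*-identityʳ b)) (/1≡⟦⟧ _)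

⟦⟧-neg : ∀ a → ℚ.- ⟦ a ⟧ ≡ ⟦ ℤ.- a ⟧
⟦⟧-neg (ℤ.+ zero) = refl
⟦⟧-neg (ℤ.+ suc a) = refl
⟦⟧-neg ℤ.-[1+ a ] = refl

⟦⟧-mono : ∀ {a b} → a ℤ.≤ b → ⟦ a ⟧ ℚ.≤ ⟦ b ⟧
⟦⟧-mono {a} {b} a≤b = ℚ.*≤* (subst₂ ℤ._≤_ (sym (ℤₚ.*-identityʳ a)) (sym (ℤₚ.*-identityʳ b)) a≤b)

centre≡ : ∀ n k c → k * suc n ≡ c * 2 → centre n k ≡ ⟦ ℤ.+ c ⟧
centre≡ n k c k[n+1]≡2c = trans (cong (λ x → (ℤ.+ x) ℚ./ 2) k[n+1]≡c*2) (trans (ℚₚ.fromℚᵘ-cong {mkℚᵘ (ℤ.+ (c * 2)) 1} {mkℚᵘ (ℤ.+ c) 0} (*≡* cross)) (/1≡⟦⟧ (ℤ.+ c)))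
  where
  k[n+1]≡c*2 : k * (n + 1) ≡ c * 2
  k[n+1]≡c*2 = trans (cong (k *_) (+-comm n 1)) k[n+1]≡2c
  cross : (ℤ.+ (c * 2)) ℤ.* (ℤ.+ 1) ≡ (ℤ.+ c) ℤ.* (ℤ.+ 2)
  cross = trans (ℤₚ.*-identityʳ _) (ℤₚ.pos-* c 2)

deviation : ∀ n k c → k * suc n ≡ c * 2 → ∀ w → (ℤ.+ w) ℚ./ 1 ℚ.- centre n k ≡ ⟦ w ⊖ c ⟧
deviation n k c k[n+1]≡2c w = begin
  (ℤ.+ w) ℚ./ 1 ℚ.- centre n k   ≡⟨ cong₂ ℚ._-_ (/1≡⟦⟧ (ℤ.+ w)) (centre≡ n k c k[n+1]≡2c) ⟩
  ⟦ ℤ.+ w ⟧ ℚ.+ ℚ.- ⟦ ℤ.+ c ⟧     ≡⟨ cong (⟦ ℤ.+ w ⟧ ℚ.+_) (⟦⟧-neg (ℤ.+ c)) ⟩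
  ⟦ ℤ.+ w ⟧ ℚ.+ ⟦ ℤ.- (ℤ.+ c) ⟧   ≡⟨ ⟦⟧-+ (ℤ.+ w) (ℤ.- (ℤ.+ c)) ⟩
  ⟦ ℤ.+ w ℤ.- ℤ.+ c ⟧            ≡⟨ cong ⟦_⟧ (ℤₚ.[+m]-[+n]≡m⊖n w c) ⟩
  ⟦ w ⊖ c ⟧                      ∎
  where open ≡-Reasoning

∣⊖∣≡∸ : ∀ {w c} → c ≤ w → ℤ.∣ w ⊖ c ∣ ≡ w ∸ c
∣⊖∣≡∸ {w} {c} c≤w = trans (ℤₚ.∣m⊖n∣≡∣n⊖m∣ w c) (ℤₚ.∣⊖∣-≤ c≤w)

exceeds⇒1≤ : ∀ {w c} → c < w → 1ℚ ℚ.≤ ⟦ w ⊖ c ⟧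
exceeds⇒1≤ {w} {c} c<w = subst (λ x → 1ℚ ℚ.≤ ⟦ x ⟧) (sym (ℤₚ.⊖-≥ (<⇒≤ c<w))) (⟦⟧-mono (+≤+ (m<n⇒0<n∸m c<w)))

exceeds⇒1≤∣∣ : ∀ {w c} → c < w → 1ℚ ℚ.≤ ℚ.∣ ⟦ w ⊖ c ⟧ ∣
exceeds⇒1≤∣∣ {w} {c} c<w = subst (λ x → 1ℚ ℚ.≤ ⟦ ℤ.+ x ⟧) (sym (∣⊖∣≡∸ (<⇒≤ c<w))) (⟦⟧-mono (+≤+ (m<n⇒0<n∸m c<w)))

near⇒∣∣≤1 : ∀ {w c} → c ≤ suc w → w ≤ suc c → ℚ.∣ ⟦ w ⊖ c ⟧ ∣ ℚ.≤ 1ℚ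
near⇒∣∣≤1 {w} {c} c≤1+w w≤1+c with ≤-total w c
... | inj₁ w≤c = subst (λ x → ⟦ ℤ.+ x ⟧ ℚ.≤ 1ℚ) (sym (ℤₚ.∣⊖∣-≤ w≤c)) (⟦⟧-mono (+≤+ (m≤n+o⇒m∸n≤o c w (subst (c ≤_) (+-comm 1 w) c≤1+w))))
... | inj₂ c≤w = subst (λ x → ⟦ ℤ.+ x ⟧ ℚ.≤ 1ℚ) (sym (∣⊖∣≡∸ c≤w)) (⟦⟧-mono (+≤+ (m≤n+o⇒m∸n≤o w c (subst (w ≤_) (+-comm 1 c) w≤1+c))))

⟦1+c⊖c⟧ : ∀ c → ⟦ suc c ⊖ c ⟧ ≡ 1ℚ
⟦1+c⊖c⟧ c = cong ⟦_⟧ (trans (ℤₚ.⊖-≥ (n≤1+n c)) (cong ℤ.+_ (m+n∸n≡m 1 c)))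

maxOverℚ : ∀ {A : Set} → (A → ℚ) → List A → ℚ
maxOverℚ g xs = foldr ℚ._⊔_ 0ℚ (map g xs)

maxOverℚ-ub : ∀ {A : Set} (g : A → ℚ) xs {x} → x ∈ xs → g x ℚ.≤ maxOverℚ g xs
maxOverℚ-ub g (y ∷ xs) (here refl) = ℚₚ.p≤p⊔q (g y) _
maxOverℚ-ub g (y ∷ xs) (there x∈xs) = ℚₚ.≤-trans (maxOverℚ-ub g xs x∈xs) (ℚₚ.p≤q⊔p (g y) _)

maxOverℚ-lub : ∀ {A : Set} (g : A → ℚ) xs {b} → 0ℚ ℚ.≤ b → (∀ x → g x ℚ.≤ b) → maxOverℚ g xs ℚ.≤ b
maxOverℚ-lub g [] 0≤b bound = 0≤b
maxOverℚ-lub g (y ∷ xs) 0≤b bound = ℚₚ.⊔-lub (bound y) (maxOverℚ-lub g xs 0≤b bound)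

module FromWindowBounds {n : ℕ} .{{_ : NonZero n}} (k c : ℕ) (0<k : 0 < k) (k<n : k < n)
                        (k[n+1]≡2c : k * suc n ≡ c * 2) where

  max-exceeds : (σ : Permutation′ n) → c < maxWindow σ k
  max-exceeds σ with Windows.some-window-exceeds σ k c 0<k k<n k[n+1]≡2c
  ... | i , c<wᵢ = <-≤-trans c<wᵢ (maxOver-ub (window σ k) (allFin n) (∈-allFin i))

  msumπ≡ : (σ : Permutation′ n) → msumπ σ k ≡ ⟦ maxWindow σ k ⊖ c ⟧
  msumπ≡ σ = deviation n k c k[n+1]≡2c (maxWindow σ k)

  msum-lower : (σ : Permutation′ n) → 1ℚ ℚ.≤ msumπ σ k
  msum-lower σ = subst (1ℚ ℚ.≤_) (sym (msumπ≡ σ)) (exceeds⇒1≤ (max-exceeds σ))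

  disc-lower : (σ : Permutation′ n) → 1ℚ ℚ.≤ discπ σ k
  disc-lower σ with Windows.some-window-exceeds σ k c 0<k k<n k[n+1]≡2c
  ... | i , c<wᵢ = ℚₚ.≤-trans
    (subst (λ x → 1ℚ ℚ.≤ ℚ.∣ x ∣) (sym (deviation n k c k[n+1]≡2c (window σ k i))) (exceeds⇒1≤∣∣ c<wᵢ))
    (maxOverℚ-ub (λ i → ℚ.∣ (ℤ.+ window σ k i) ℚ./ 1 ℚ.- centre n k ∣) (allFin n) (∈-allFin i))

  msumEq : (σ : Permutation′ n) → (∀ i → window σ k i ≤ suc c) → MsumEq n k 1ℚ
  msumEq σ bounded = (σ , msumπ≡1) , msum-lower
    where
    max≡1+c : maxWindow σ k ≡ suc c
    max≡1+c = ≤-antisym (maxOver-lub (window σ k) (allFin n) bounded) (max-exceeds σ)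
    msumπ≡1 : msumπ σ k ≡ 1ℚ
    msumπ≡1 = trans (msumπ≡ σ) (trans (cong (λ w → ⟦ w ⊖ c ⟧) max≡1+c) (⟦1+c⊖c⟧ c))

  discEq : (σ : Permutation′ n) → (∀ i → c ≤ suc (window σ k i)) → (∀ i → window σ k i ≤ suc c) → DiscEq n k 1ℚ
  discEq σ above below = (σ , ℚₚ.≤-antisym disc≤1 (disc-lower σ)) , disc-lower
    where
    disc≤1 : discπ σ k ℚ.≤ 1ℚ
    disc≤1 = maxOverℚ-lub _ (allFin n) (⟦⟧-mono (+≤+ z≤n))
      (λ i → subst (λ x → ℚ.∣ x ∣ ℚ.≤ 1ℚ) (sym (deviation n k c k[n+1]≡2c (window σ k i))) (near⇒∣∣≤1 (above i) (below i)))

[s+ad]%d≡s : ∀ s a d .{{_ : NonZero d}} → s < d → (s + a * d) % d ≡ s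
[s+ad]%d≡s s a d s<d = trans ([m+kn]%n≡m%n s a d) (m<n⇒m%n≡m s<d)

[s+ad]/d≡a : ∀ s a d .{{_ : NonZero d}} → s < d → (s + a * d) / d ≡ a
[s+ad]/d≡a s a d s<d = trans (+-distrib-/-∣ʳ s (divides-refl a)) (cong₂ _+_ (m<n⇒m/n≡0 s<d) (m*n/n≡m a d))

[s+ad]%Ld : ∀ s a L d .{{_ : NonZero L}} .{{_ : NonZero (L * d)}} → s < d →
            (s + a * d) % (L * d) ≡ s + (a % L) * d
[s+ad]%Ld s a L d s<d = begin
  (s + a * d) % (L * d)          ≡⟨ cong (_% (L * d)) (+-comm s (a * d)) ⟩
  (a * d + s) % (L * d)          ≡⟨ [m*n+o]%[p*n]≡[m*n]%[p*n]+o a L s<d ⟩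
  (a * d) % (L * d) + s          ≡⟨ cong (_+ s) (m%n*o≡m*o%[n*o] a L d) ⟨
  (a % L) * d + s                ≡⟨ +-comm _ s ⟩
  s + (a % L) * d                ∎
  where open ≡-Reasoning

*-%ʳ : ∀ a b N .{{_ : NonZero N}} → (a * (b % N)) % N ≡ (a * b) % N
*-%ʳ a b N = begin
  (a * (b % N)) % N              ≡⟨ %-distribˡ-* a (b % N) N ⟩
  ((a % N) * (b % N % N)) % N    ≡⟨ cong (λ z → ((a % N) * z) % N) (m%n%n≡m%n b N) ⟩
  ((a % N) * (b % N)) % N        ≡⟨ %-distribˡ-* a b N ⟨
  (a * b) % N                    ∎
  where open ≡-Reasoning

record InverseOn (n : ℕ) (f g : ℕ → ℕ) : Set where
  field
    f< : ∀ x → x < n → f x < n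
    g< : ∀ y → y < n → g y < n
    g∘f : ∀ x → x < n → g (f x) ≡ x
    f∘g : ∀ y → y < n → f (g y) ≡ y

InverseOn-∘ : ∀ {n f g f′ g′} → InverseOn n f g → InverseOn n f′ g′ → InverseOn n (f′ ∘ f) (g ∘ g′)
InverseOn-∘ {f = f} {g} {f′} {g′} inv inv′ = record
  { f< = λ x x<n → I′.f< (f x) (I.f< x x<n)
  ; g< = λ y y<n → I.g< (g′ y) (I′.g< y y<n)
  ; g∘f = λ x x<n → trans (cong g (I′.g∘f (f x) (I.f< x x<n))) (I.g∘f x x<n)
  ; f∘g = λ y y<n → trans (cong f′ (I.f∘g (g′ y) (I′.g< y y<n))) (I′.f∘g y y<n)
  }
  where
  module I = InverseOn inv
  module I′ = InverseOn inv′

reversal : ℕ → ℕ → ℕ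
reversal n x = n ∸ suc x

reversal-inverse : ∀ n → InverseOn n (reversal n) (reversal n)
reversal-inverse n = record { f< = reversal< ; g< = reversal< ; g∘f = reversal-involutive ; f∘g = reversal-involutive }
  where
  reversal< : ∀ x → x < n → reversal n x < n
  reversal< x x<n = ∸-monoʳ-< z<s x<n
  reversal-involutive : ∀ x → x < n → reversal n (reversal n x) ≡ x
  reversal-involutive x x<n = trans (cong (n ∸_) (sym (+-∸-assoc 1 x<n))) (m∸[m∸n]≡n (<⇒≤ x<n))

module _ {n : ℕ} .{{_ : NonZero n}} {f g : ℕ → ℕ} (inv : InverseOn n f g) where
  open InverseOn inv

  toPermutation : Permutation′ n
  toPermutation = permutation (λ i → fromℕ< (f< (toℕ i) (Finₚ.toℕ<n i))) (λ i → fromℕ< (g< (toℕ i) (Finₚ.toℕ<n i)))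
    (λ y → Finₚ.toℕ-injective (trans (Finₚ.toℕ-fromℕ< _) (trans (cong f (Finₚ.toℕ-fromℕ< _)) (f∘g _ (Finₚ.toℕ<n y)))))
    (λ x → Finₚ.toℕ-injective (trans (Finₚ.toℕ-fromℕ< _) (trans (cong g (Finₚ.toℕ-fromℕ< _)) (g∘f _ (Finₚ.toℕ<n x)))))

  πval-toPermutation : ∀ x → πval toPermutation x ≡ suc (f (x % n))
  πval-toPermutation x = cong suc (trans (Finₚ.toℕ-fromℕ< _) (cong f (Finₚ.toℕ-fromℕ< _)))

-- Read positions 0, …, L·w−1 as L rows of width w (y = s + r·w with s < w) and send y
-- to φ s r + s·L: every column s is permuted by φ s and the grid is read column by column.
module Transpose (w L : ℕ) .{{_ : NonZero w}} .{{_ : NonZero L}} (φ ψ : ℕ → ℕ → ℕ)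
                 (columns : ∀ s → s < w → InverseOn L (φ s) (ψ s)) where

  instance
    L*w≢0 : NonZero (L * w)
    L*w≢0 = m*n≢0 L w

  transposed untransposed : ℕ → ℕ
  transposed y = φ (y % w) (y / w) + (y % w) * L
  untransposed x = x / L + ψ (x / L) (x % L) * w

  transposed-at : ∀ s r → s < w → transposed (s + r * w) ≡ φ s r + s * L
  transposed-at s r s<w = cong₂ (λ a b → φ b a + b * L) ([s+ad]/d≡a s r w s<w) ([s+ad]%d≡s s r w s<w)

  untransposed-at : ∀ s y → y < L → untransposed (y + s * L) ≡ s + ψ s y * w
  untransposed-at s y y<L = cong₂ (λ a b → b + ψ b a * w) ([s+ad]%d≡s y s L y<L) ([s+ad]/d≡a y s L y<L)

  transposed-mod : ∀ s a → s < w → transposed ((s + a * w) % (L * w)) ≡ φ s (a % L) + s * L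
  transposed-mod s a s<w = trans (cong transposed ([s+ad]%Ld s a L w s<w)) (transposed-at s (a % L) s<w)

  transpose-inverse : InverseOn (L * w) transposed untransposed
  transpose-inverse = record { f< = f< ; g< = g< ; g∘f = g∘f ; f∘g = f∘g }
    where
    module Col s (s<w : s < w) = InverseOn (columns s s<w)
    grid< : ∀ {s r a b} → s < a → r < b → s + r * a < b * a
    grid< {s} {r} {a} {b} s<a r<b = begin-strict
      s + r * a   <⟨ +-monoˡ-< (r * a) s<a ⟩
      suc r * a   ≤⟨ *-monoˡ-≤ a r<b ⟩
      b * a       ∎
      where open ≤-Reasoning
    row< : ∀ y → y < L * w → y / w < L
    row< y y<Lw = m<n*o⇒m/o<n y<Lw
    col< : ∀ x → x < L * w → x / L < w
    col< x x<Lw = m<n*o⇒m/o<n (subst (x <_) (*-comm L w) x<Lw)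
    f< : ∀ y → y < L * w → transposed y < L * w
    f< y y<Lw = subst (transposed y <_) (*-comm w L)
      (grid< (Col.f< (y % w) (m%n<n y w) (y / w) (row< y y<Lw)) (m%n<n y w))
    g< : ∀ x → x < L * w → untransposed x < L * w
    g< x x<Lw = grid< (col< x x<Lw) (Col.g< (x / L) (col< x x<Lw) (x % L) (m%n<n x L))
    g∘f : ∀ y → y < L * w → untransposed (transposed y) ≡ y
    g∘f y y<Lw = begin
      untransposed (φ s r + s * L)  ≡⟨ untransposed-at s (φ s r) (Col.f< s s<w r (row< y y<Lw)) ⟩
      s + ψ s (φ s r) * w           ≡⟨ cong (λ t → s + t * w) (Col.g∘f s s<w r (row< y y<Lw)) ⟩
      s + r * w                     ≡⟨ m≡m%n+[m/n]*n y w ⟨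
      y                             ∎
      where
      open ≡-Reasoning
      s r : ℕ
      s = y % w
      r = y / w
      s<w : s < w
      s<w = m%n<n y w
    f∘g : ∀ x → x < L * w → transposed (untransposed x) ≡ x
    f∘g x x<Lw = begin
      transposed (t + ψ t z * w)  ≡⟨ transposed-at t (ψ t z) (col< x x<Lw) ⟩
      φ t (ψ t z) + t * L         ≡⟨ cong (_+ t * L) (Col.f∘g t (col< x x<Lw) z (m%n<n x L)) ⟩
      z + t * L                   ≡⟨ m≡m%n+[m/n]*n x L ⟨
      x                           ∎
      where
      open ≡-Reasoning
      t z : ℕ
      t = x / L
      z = x % L

  σ : Permutation′ (L * w)
  σ = toPermutation transpose-inverse

  π-at : ∀ s a → s < w → πval σ (s + a * w) ≡ suc (φ s (a % L) + s * L)
  π-at s a s<w = trans (πval-toPermutation transpose-inverse (s + a * w)) (cong suc (transposed-mod s a s<w))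

-- Even case: k = 2m with m = 2d, n = N·m with N = 2q+1, so n = 2H for H = N·d.
-- π_{2j} = 1 + v(j mod H) and π_{2j+1} = n − v(j mod H) for a permutation v of
-- {0, …, H−1}; hence windows starting at even positions sum exactly to c = m(n+1),
-- and a window starting at 2j+1 exceeds c by π_{2j+k} − π_{2j} ≤ 1.
module EvenCase (q h : ℕ) where

  N d m H n k c : ℕ
  N = suc (q * 2)
  d = suc h
  m = d * 2
  H = N * d
  n = H * 2
  k = m * 2
  c = m * suc n

  -- r ↦ (q+1)·r mod N halves modulo N (2(q+1) ≡ 1), with inverse x ↦ 2x mod N.
  halve double : ℕ → ℕ
  halve r = (suc q * r) % N
  double x = (2 * x) % N

  halve-mod : ∀ r → halve (r % N) ≡ halve r
  halve-mod r = *-%ʳ (suc q) r N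

  halve-inverse : InverseOn N halve double
  halve-inverse = record
    { f< = λ r _ → m%n<n (suc q * r) N
    ; g< = λ x _ → m%n<n (2 * x) N
    ; g∘f = λ r r<N → begin
        (2 * ((suc q * r) % N)) % N ≡⟨ *-%ʳ 2 (suc q * r) N ⟩
        (2 * (suc q * r)) % N       ≡⟨ cong (_% N) (twice-half q r) ⟩
        (r + r * N) % N             ≡⟨ [s+ad]%d≡s r r N r<N ⟩
        r                           ∎
    ; f∘g = λ x x<N → begin
        (suc q * ((2 * x) % N)) % N ≡⟨ *-%ʳ (suc q) (2 * x) N ⟩
        (suc q * (2 * x)) % N       ≡⟨ cong (_% N) (half-twice q x) ⟩
        (x + x * N) % N             ≡⟨ [s+ad]%d≡s x x N x<N ⟩
        x                           ∎
    }
    where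
    open ≡-Reasoning
    twice-half : ∀ q r → 2 * (suc q * r) ≡ r + r * suc (q * 2)
    twice-half = solve-∀
    half-twice : ∀ q x → suc q * (2 * x) ≡ x + x * suc (q * 2)
    half-twice = solve-∀

  halve-step : ∀ r → halve (2 + r) ≤ suc (halve r)
  halve-step r = begin
    (suc q * (2 + r)) % N           ≡⟨ cong (_% N) (shift q r) ⟩
    ((1 + suc q * r) + 1 * N) % N   ≡⟨ [m+kn]%n≡m%n (1 + suc q * r) 1 N ⟩
    (1 + suc q * r) % N             ≡⟨ %-distribˡ-+ 1 (suc q * r) N ⟩
    (1 % N + halve r) % N           ≤⟨ m%n≤m _ N ⟩
    1 % N + halve r                 ≤⟨ +-monoˡ-≤ (halve r) (m%n≤m 1 N) ⟩
    suc (halve r)                   ∎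
    where
    open ≤-Reasoning
    shift : ∀ q r → suc q * (2 + r) ≡ (1 + suc q * r) + 1 * suc (q * 2)
    shift = solve-∀

  -- v permutes {0, …, H−1}: reading j = o + r·d, v j = halve r + o·N.
  open Transpose d N (λ _ → halve) (λ _ → double) (λ _ _ → halve-inverse)
    using () renaming (transposed to v; untransposed to v⁻¹; transpose-inverse to v-inverse; transposed-mod to v-mod)

  -- Shifting by m = 2d moves two rows down, so v grows by at most one.
  v-step : ∀ j → v ((j + m) % H) ≤ suc (v (j % H))
  v-step j = begin
    v ((j + m) % H)                ≡⟨ cong (λ x → v (x % H)) j+m≡ ⟩
    v ((o + (2 + a) * d) % H)      ≡⟨ v-mod o (2 + a) o<d ⟩
    halve ((2 + a) % N) + o * N    ≡⟨ cong (_+ o * N) (halve-mod (2 + a)) ⟩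
    halve (2 + a) + o * N          ≤⟨ +-monoˡ-≤ (o * N) (halve-step a) ⟩
    suc (halve a + o * N)          ≡⟨ cong (λ x → suc (x + o * N)) (halve-mod a) ⟨
    suc (halve (a % N) + o * N)    ≡⟨ cong suc (v-mod o a o<d) ⟨
    suc (v ((o + a * d) % H))      ≡⟨ cong (λ x → suc (v (x % H))) (m≡m%n+[m/n]*n j d) ⟨
    suc (v (j % H))                ∎
    where
    open ≤-Reasoning
    o a : ℕ
    o = j % d
    a = j / d
    o<d : o < d
    o<d = m%n<n j d
    j+m≡ : j + m ≡ o + (2 + a) * d
    j+m≡ = trans (cong (_+ m) (m≡m%n+[m/n]*n j d)) (regroup o a d)
      where
      regroup : ∀ o a d → o + a * d + d * 2 ≡ o + (2 + a) * d
      regroup = solve-∀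

  -- π pairs each v-value x at position 2j with its complement n − x at 2j+1; as a grid of
  -- H rows of width 2, column 0 is v and column 1 is v followed by the reversal of {0, …, H−1}.
  column column⁻¹ : ℕ → ℕ → ℕ
  column zero = v
  column (suc _) = reversal H ∘ v
  column⁻¹ zero = v⁻¹
  column⁻¹ (suc _) = v⁻¹ ∘ reversal H

  columns : ∀ s → s < 2 → InverseOn H (column s) (column⁻¹ s)
  columns zero _ = v-inverse
  columns (suc _) _ = InverseOn-∘ v-inverse (reversal-inverse H)

  open Transpose 2 H column column⁻¹ columns public using (σ; π-at)
  open Windows σ using (P; W; W-slide; window≡W)

  P-even : ∀ j → P (j * 2) ≡ suc (v (j % H))
  P-even j = trans (π-at 0 j z<s) (cong suc (+-identityʳ _))

  pair-sum : ∀ j → P (j * 2) + P (suc (j * 2)) ≡ suc n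
  pair-sum j = begin
    P (j * 2) + P (suc (j * 2))                 ≡⟨ cong₂ _+_ (P-even j) (π-at 1 j (s<s z<s)) ⟩
    suc x + suc ((H ∸ suc x) + (H + 0))         ≡⟨ cong (λ y → suc x + suc ((H ∸ suc x) + y)) (+-identityʳ H) ⟩
    suc x + suc ((H ∸ suc x) + H)               ≡⟨ +-suc (suc x) _ ⟩
    suc (suc x + ((H ∸ suc x) + H))             ≡⟨ cong suc (+-assoc (suc x) _ H) ⟨
    suc (suc x + (H ∸ suc x) + H)               ≡⟨ cong (λ y → suc (y + H)) (m+[n∸m]≡n x<H) ⟩
    suc (H + H)                                 ≡⟨ cong (λ y → suc (H + y)) (+-identityʳ H) ⟨
    suc (2 * H)                                 ≡⟨ cong suc (*-comm 2 H) ⟩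
    suc n                                       ∎
    where
    open ≡-Reasoning
    x : ℕ
    x = v (j % H)
    x<H : x < H
    x<H = InverseOn.f< v-inverse (j % H) (m%n<n j H)

  -- Windows starting at even positions consist of m whole pairs.
  W-even : ∀ j → W (j * 2) k ≡ c
  W-even j = begin
    W (j * 2) (m * 2)                                                  ≡⟨ sumTo-pairs (λ u → P (j * 2 + u)) m ⟩
    sumTo (λ u → P (j * 2 + u * 2) + P (j * 2 + suc (u * 2))) m        ≡⟨ sumTo-cong m (λ u _ → whole-pair u) ⟩
    sumTo (λ _ → suc n) m                                              ≡⟨ sumTo-const (suc n) m ⟩
    c                                                                  ∎
    where
    open ≡-Reasoning
    whole-pair : ∀ u → P (j * 2 + u * 2) + P (j * 2 + suc (u * 2)) ≡ suc n
    whole-pair u = trans (cong₂ (λ x y → P x + P y) (sym (*-distribʳ-+ 2 j u))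
                                (trans (+-suc (j * 2) (u * 2)) (cong suc (sym (*-distribʳ-+ 2 j u)))))
                         (pair-sum (j + u))

  P-step : ∀ j → P (j * 2 + k) ≤ suc (P (j * 2))
  P-step j = begin
    P (j * 2 + m * 2)       ≡⟨ cong P (*-distribʳ-+ 2 j m) ⟨
    P ((j + m) * 2)         ≡⟨ P-even (j + m) ⟩
    suc (v ((j + m) % H))   ≤⟨ s≤s (v-step j) ⟩
    suc (suc (v (j % H)))   ≡⟨ cong suc (P-even j) ⟨
    suc (P (j * 2))         ∎
    where open ≤-Reasoning

  -- Sliding from 2j to 2j+1 replaces π_{2j} by the at most one larger π_{2j+k}.
  W-odd : ∀ j → W (suc (j * 2)) k ≤ suc c
  W-odd j = +-cancelʳ-≤ (P (j * 2)) _ _ (begin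
    W (suc (j * 2)) k + P (j * 2)  ≡⟨ W-slide (j * 2) k ⟩
    W (j * 2) k + P (j * 2 + k)    ≤⟨ +-mono-≤ (≤-reflexive (W-even j)) (P-step j) ⟩
    c + suc (P (j * 2))            ≡⟨ +-suc c _ ⟩
    suc c + P (j * 2)              ∎)
    where open ≤-Reasoning

  windows-bounded : ∀ (i : Fin n) → window σ k i ≤ suc c
  windows-bounded i = subst (_≤ suc c) (sym (window≡W k i)) (W-bounded (toℕ i))
    where
    W-bounded : ∀ p → W p k ≤ suc c
    W-bounded p with evenOdd p
    ... | twice j = ≤-trans (≤-reflexive (W-even j)) (n≤1+n c)
    ... | twice+1 j = W-odd j

parity-suc : ∀ x → parity (suc x) ≡ parity x ⁻¹
parity-suc x = ℙₚ.+-homo-+ 1 x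

parity-*2 : ∀ x → parity (x * 2) ≡ 0ℙ
parity-*2 x = trans (ℙₚ.*-homo-* x 2) (ℙₚ.*-zeroʳ (parity x))

parity-grid : ∀ h s a → parity (s + a * suc (h * 2)) ≡ parity s ℙ.+ parity a
parity-grid h s a = begin
  parity (s + a * m)                   ≡⟨ ℙₚ.+-homo-+ s (a * m) ⟩
  parity s ℙ.+ parity (a * m)          ≡⟨ cong (parity s ℙ.+_) (ℙₚ.*-homo-* a m) ⟩
  parity s ℙ.+ (parity a ℙ.* parity m) ≡⟨ cong (λ p → parity s ℙ.+ (parity a ℙ.* p)) (trans (parity-suc (h * 2)) (cong _⁻¹ (parity-*2 h))) ⟩
  parity s ℙ.+ (parity a ℙ.* 1ℙ)       ≡⟨ cong (parity s ℙ.+_) (ℙₚ.*-identityʳ (parity a)) ⟩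
  parity s ℙ.+ parity a                ∎
  where
  open ≡-Reasoning
  m : ℕ
  m = suc (h * 2)

-- View positions as
-- N rows of width m (y = s + r·m).  In column s, row r carries 1 + s·N + r or
-- 1 + s·N + (N−1−r), according to the parity of y.  Then the entries at y and y+m sum to
-- N(2s+1) + excess y with excess y ∈ {0,1,2}, and the excesses telescope against a
-- potential in {0,1}, so every window sum lies within 1 of c = m(n+1).
module OddCase (q h : ℕ) where

  N Q2 m n k c : ℕ
  N = suc (q * 2)
  Q2 = q * 2
  m = suc (h * 2)
  n = N * m
  k = m * 2
  c = m * suc n

  flipIf : Parity → ℕ → ℕ
  flipIf 0ℙ r = r
  flipIf 1ℙ r = reversal N r

  column : ℕ → ℕ → ℕ
  column s r = flipIf (parity (s + r * m)) r

  -- N−1−r has the parity of r, since N−1 is even.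
  parity-reversal : ∀ r → r < N → parity (reversal N r) ≡ parity r
  parity-reversal r r<N = ℙₚ.+-cancelʳ-≡ (parity r) _ _ (begin
    parity (reversal N r) ℙ.+ parity r  ≡⟨ ℙₚ.+-homo-+ (reversal N r) r ⟨
    parity (Q2 ∸ r + r)                 ≡⟨ cong parity (m∸n+n≡m (s≤s⁻¹ r<N)) ⟩
    parity Q2                           ≡⟨ parity-*2 q ⟩
    0ℙ                                  ≡⟨ ℙₚ.p+p≡0ℙ (parity r) ⟨
    parity r ℙ.+ parity r               ∎)
    where open ≡-Reasoning

  -- Each column map is an involution of {0, …, N−1}: reflecting preserves the parity of r.
  column-involution : ∀ s → InverseOn N (column s) (column s)
  column-involution s = record { f< = column< ; g< = column< ; g∘f = involutive ; f∘g = involutive }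
    where
    column< : ∀ r → r < N → column s r < N
    column< r r<N with parity (s + r * m)
    ... | 0ℙ = r<N
    ... | 1ℙ = InverseOn.f< (reversal-inverse N) r r<N
    same-parity : ∀ r → r < N → parity (s + column s r * m) ≡ parity (s + r * m)
    same-parity r r<N with parity (s + r * m) in eq
    ... | 0ℙ = eq
    ... | 1ℙ = trans (parity-grid h s (reversal N r)) (trans (cong (parity s ℙ.+_) (parity-reversal r r<N)) (trans (sym (parity-grid h s r)) eq))
    flipIf-involutive : ∀ p r → r < N → flipIf p (flipIf p r) ≡ r
    flipIf-involutive 0ℙ r _ = refl
    flipIf-involutive 1ℙ r r<N = InverseOn.g∘f (reversal-inverse N) r r<N
    involutive : ∀ r → r < N → column s (column s r) ≡ r
    involutive r r<N = trans (cong (λ p → flipIf p (column s r)) (same-parity r r<N)) (flipIf-involutive (parity (s + r * m)) r r<N)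

  open Transpose m N column column (λ s _ → column-involution s) public using (σ; π-at)
  open Windows σ using (P; W; window≡W; P-+kn)

  bit : Parity → ℕ
  bit 0ℙ = 0
  bit 1ℙ = 1

  -- The rows 0, …, N−2 (positions y < (N−1)·m) form the body; the last row is special.
  -- In the body the entries at y and y+m exceed N(2s+1) by 0 or 2, alternately along the
  -- positions; across the last row (and the wrap-around) the excess is 1.
  excess potential : ℕ → ℕ
  excess y with y <? Q2 * m
  ... | yes _ = bit (parity y) * 2
  ... | no _ = 1
  potential y with y <? Q2 * m
  ... | yes _ = bit (parity y)
  ... | no _ = 0

  excess-body : ∀ y → y < Q2 * m → excess y ≡ bit (parity y) * 2
  excess-body y y<body with y <? Q2 * m
  ... | yes _ = refl
  ... | no y≮body = contradiction y<body y≮body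
  excess-last : ∀ y → Q2 * m ≤ y → excess y ≡ 1
  excess-last y body≤y with y <? Q2 * m
  ... | yes y<body = contradiction y<body (≤⇒≯ body≤y)
  ... | no _ = refl
  potential-body : ∀ y → y < Q2 * m → potential y ≡ bit (parity y)
  potential-body y y<body with y <? Q2 * m
  ... | yes _ = refl
  ... | no y≮body = contradiction y<body y≮body
  potential-last : ∀ y → Q2 * m ≤ y → potential y ≡ 0
  potential-last y body≤y with y <? Q2 * m
  ... | yes y<body = contradiction y<body (≤⇒≯ body≤y)
  ... | no _ = refl

  potential≤1 : ∀ y → potential y ≤ 1
  potential≤1 y with y <? Q2 * m
  ... | yes _ = bit≤1 (parity y)
    where
    bit≤1 : ∀ p → bit p ≤ 1
    bit≤1 0ℙ = z≤n
    bit≤1 1ℙ = ≤-refl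
  ... | no _ = z≤n

  -- Position 0 is even (or lies in the last row when N = 1).
  potential-0 : potential 0 ≡ 0
  potential-0 with 0 <? Q2 * m
  ... | yes _ = refl
  ... | no _ = refl

  body<n : Q2 * m < n
  body<n = +-monoˡ-< (Q2 * m) {0} {m} z<s

  excess-balance : ∀ y → y < n → excess y + potential (suc y % n) ≡ 1 + potential y
  excess-balance y y<n with suc y <? Q2 * m
  ... | yes 1+y<body = begin
    excess y + potential (suc y % n)  ≡⟨ cong₂ _+_ (excess-body y y<body) (cong potential (m<n⇒m%n≡m (<-trans 1+y<body body<n))) ⟩
    bit p * 2 + potential (suc y)     ≡⟨ cong (bit p * 2 +_) (trans (potential-body (suc y) 1+y<body) (cong bit (parity-suc y))) ⟩
    bit p * 2 + bit (p ⁻¹)            ≡⟨ alternate p ⟩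
    1 + bit p                         ≡⟨ cong suc (potential-body y y<body) ⟨
    1 + potential y                   ∎
    where
    open ≡-Reasoning
    p : Parity
    p = parity y
    y<body : y < Q2 * m
    y<body = <-trans (n<1+n y) 1+y<body
    alternate : ∀ p → bit p * 2 + bit (p ⁻¹) ≡ 1 + bit p
    alternate 0ℙ = refl
    alternate 1ℙ = refl
  ... | no 1+y≮body with suc y ≟ Q2 * m
  ...   | yes 1+y≡body = begin
    excess y + potential (suc y % n)  ≡⟨ cong₂ _+_ (excess-body y y<body) (cong potential (m<n⇒m%n≡m (subst (_< n) (sym 1+y≡body) body<n))) ⟩
    bit (parity y) * 2 + potential (suc y) ≡⟨ cong₂ (λ p x → bit p * 2 + x) y-odd (potential-last (suc y) (≤-reflexive (sym 1+y≡body))) ⟩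
    2 + 0                             ≡⟨ cong (λ p → 1 + bit p) y-odd ⟨
    1 + bit (parity y)                ≡⟨ cong suc (potential-body y y<body) ⟨
    1 + potential y                   ∎
    where
    open ≡-Reasoning
    y<body : y < Q2 * m
    y<body = ≤-reflexive 1+y≡body
    y-odd : parity y ≡ 1ℙ
    y-odd = ℙₚ.⁻¹-injective (trans (sym (parity-suc y)) (trans (cong parity 1+y≡body)
              (trans (ℙₚ.*-homo-* Q2 m) (cong (ℙ._* parity m) (parity-*2 q)))))
  ...   | no 1+y≢body = begin
    excess y + potential (suc y % n)  ≡⟨ cong₂ _+_ (excess-last y body≤y) next-potential ⟩
    1 + 0                             ≡⟨ cong suc (potential-last y body≤y) ⟨
    1 + potential y                   ∎
    where
    open ≡-Reasoning
    body≤y : Q2 * m ≤ y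
    body≤y = s≤s⁻¹ (≤∧≢⇒< (≮⇒≥ 1+y≮body) (λ e → 1+y≢body (sym e)))
    next-potential : potential (suc y % n) ≡ 0
    next-potential with m≤n⇒m<n∨m≡n y<n
    ... | inj₁ 1+y<n = trans (cong potential (m<n⇒m%n≡m 1+y<n)) (potential-last (suc y) (m≤n⇒m≤1+n body≤y))
    ... | inj₂ 1+y≡n = trans (cong potential (trans (cong (_% n) 1+y≡n) (n%n≡0 n))) potential-0

  excess-sum : ∀ p l → sumTo (λ j → excess ((p + j) % n)) l + potential ((p + l) % n) ≡ l * 1 + potential (p % n)
  excess-sum = sumTo-telescope (λ z → excess (z % n)) (λ z → potential (z % n)) 1 balance
    where
    suc-% : ∀ z → suc z % n ≡ suc (z % n) % n
    suc-% z = trans (cong (λ x → suc x % n) (m≡m%n+[m/n]*n z n)) ([m+kn]%n≡m%n (suc (z % n)) (z / n) n)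
    balance : ∀ z → excess (z % n) + potential (suc z % n) ≡ 1 + potential (z % n)
    balance z = trans (cong (λ x → excess (z % n) + potential x) (suc-% z)) (excess-balance (z % n) (m%n<n z n))

  pair-total : ∀ s a b e → suc (suc (a + b)) ≡ N + e → suc (a + s * N) + suc (b + s * N) ≡ N * suc (s * 2) + e
  pair-total s a b e a+b+2≡N+e = begin
    suc (a + s * N) + suc (b + s * N) ≡⟨ regroup a b (s * N) ⟩
    suc (suc (a + b)) + s * N * 2     ≡⟨ cong (_+ s * N * 2) a+b+2≡N+e ⟩
    N + e + s * N * 2                 ≡⟨ columns N e s ⟩
    N * suc (s * 2) + e               ∎
    where
    open ≡-Reasoning
    regroup : ∀ a b x → suc (a + x) + suc (b + x) ≡ suc (suc (a + b)) + x * 2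
    regroup = solve-∀
    columns : ∀ N e s → N + e + s * N * 2 ≡ N * suc (s * 2) + e
    columns = solve-∀

  body-pair : ∀ s r p → suc r < N → suc (flipIf p r + s * N) + suc (flipIf (p ⁻¹) (suc r) + s * N) ≡ N * suc (s * 2) + bit p * 2
  body-pair s r 0ℙ 1+r<N = pair-total s r (reversal N (suc r)) 0 (trans (m+[n∸m]≡n 1+r<N) (sym (+-identityʳ N)))
  body-pair s r 1ℙ 1+r<N = pair-total s (reversal N r) (suc r) 2 (trans (cong (λ x → suc (suc x)) (m∸n+n≡m (<⇒≤ 1+r<N))) (+-comm 2 N))

  last-pair : ∀ s p → suc (flipIf p Q2 + s * N) + suc (flipIf p 0 + s * N) ≡ N * suc (s * 2) + 1
  last-pair s 0ℙ = pair-total s Q2 0 1 (trans (cong (λ x → suc (suc x)) (+-identityʳ Q2)) (+-comm 1 N))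
  last-pair s 1ℙ = pair-total s (reversal N Q2) Q2 1 (trans (cong (λ x → suc (suc (x + Q2))) (n∸n≡0 Q2)) (+-comm 1 N))

  parity-flip : ∀ p q → p ℙ.+ q ⁻¹ ≡ (p ℙ.+ q) ⁻¹
  parity-flip 0ℙ q = refl
  parity-flip 1ℙ q = refl

  pair-at : ∀ s r → s < m → r < N → P (s + r * m) + P (s + r * m + m) ≡ N * suc (s * 2) + excess (s + r * m)
  pair-at s r s<m r<N with m≤n⇒m<n∨m≡n (s≤s⁻¹ r<N)
  ... | inj₁ r<Q2 = begin
    P (s + r * m) + P (s + r * m + m)                           ≡⟨ cong₂ _+_ (π-at s r s<m) (trans (cong P next-row) (π-at s (suc r) s<m)) ⟩
    suc (column s (r % N) + s * N) + suc (column s (suc r % N) + s * N)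
        ≡⟨ cong₂ (λ x z → suc (column s x + s * N) + suc (column s z + s * N)) (m<n⇒m%n≡m r<N) (m<n⇒m%n≡m 1+r<N) ⟩
    suc (column s r + s * N) + suc (column s (suc r) + s * N)   ≡⟨ cong (λ p → suc (column s r + s * N) + suc (flipIf p (suc r) + s * N)) parity-next ⟩
    suc (flipIf p r + s * N) + suc (flipIf (p ⁻¹) (suc r) + s * N) ≡⟨ body-pair s r p 1+r<N ⟩
    N * suc (s * 2) + bit p * 2                                 ≡⟨ cong (N * suc (s * 2) +_) (excess-body (s + r * m) in-body) ⟨
    N * suc (s * 2) + excess (s + r * m)                        ∎
    where
    open ≡-Reasoning
    p : Parity
    p = parity (s + r * m)
    1+r<N : suc r < N
    1+r<N = s≤s r<Q2
    next-row : s + r * m + m ≡ s + suc r * m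
    next-row = trans (+-assoc s (r * m) m) (cong (s +_) (+-comm (r * m) m))
    parity-next : parity (s + suc r * m) ≡ p ⁻¹
    parity-next = trans (parity-grid h s (suc r)) (trans (cong (parity s ℙ.+_) (parity-suc r))
                    (trans (parity-flip (parity s) (parity r)) (cong _⁻¹ (sym (parity-grid h s r)))))
    in-body : s + r * m < Q2 * m
    in-body = ≤-trans (+-monoˡ-< (r * m) s<m) (*-monoˡ-≤ m r<Q2)
  ... | inj₂ refl = begin
    P (s + Q2 * m) + P (s + Q2 * m + m)                         ≡⟨ cong₂ _+_ (π-at s Q2 s<m) (trans (cong P wrap) (π-at s N s<m)) ⟩
    suc (column s (Q2 % N) + s * N) + suc (column s (N % N) + s * N)
        ≡⟨ cong₂ (λ x z → suc (column s x + s * N) + suc (column s z + s * N)) (m<n⇒m%n≡m r<N) (n%n≡0 N) ⟩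
    suc (flipIf (parity (s + Q2 * m)) Q2 + s * N) + suc (flipIf (parity (s + 0)) 0 + s * N)
        ≡⟨ cong₂ (λ p p′ → suc (flipIf p Q2 + s * N) + suc (flipIf p′ 0 + s * N)) parity-last (cong parity (+-identityʳ s)) ⟩
    suc (flipIf (parity s) Q2 + s * N) + suc (flipIf (parity s) 0 + s * N) ≡⟨ last-pair s (parity s) ⟩
    N * suc (s * 2) + 1                                          ≡⟨ cong (N * suc (s * 2) +_) (excess-last (s + Q2 * m) (m≤n+m (Q2 * m) s)) ⟨
    N * suc (s * 2) + excess (s + Q2 * m)                        ∎
    where
    open ≡-Reasoning
    wrap : s + Q2 * m + m ≡ s + N * m
    wrap = trans (+-assoc s (Q2 * m) m) (cong (s +_) (+-comm (Q2 * m) m))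
    parity-last : parity (s + Q2 * m) ≡ parity s
    parity-last = trans (parity-grid h s Q2) (trans (cong (parity s ℙ.+_) (parity-*2 q)) (ℙₚ.+-identityʳ (parity s)))

  pair : ∀ x → P x + P (x + m) ≡ N * suc ((x % m) * 2) + excess (x % n)
  pair x = begin
    P x + P (x + m)                              ≡⟨ cong (λ z → P z + P (z + m)) (m≡m%n+[m/n]*n x n) ⟩
    P (y + a * n) + P (y + a * n + m)            ≡⟨ cong₂ _+_ (P-+kn y a) (trans (cong P (xy∙z≈xz∙y y (a * n) m)) (P-+kn (y + m) a)) ⟩
    P y + P (y + m)                              ≡⟨ cong (λ z → P z + P (z + m)) (m≡m%n+[m/n]*n y m) ⟩
    P (s + r * m) + P (s + r * m + m)            ≡⟨ pair-at s r (m%n<n y m) (m<n*o⇒m/o<n (m%n<n x n)) ⟩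
    N * suc (s * 2) + excess (s + r * m)         ≡⟨ cong₂ (λ z w → N * suc (z * 2) + excess w) (m∣n⇒o%n%m≡o%m m n x (divides-refl N)) (sym (m≡m%n+[m/n]*n y m)) ⟩
    N * suc ((x % m) * 2) + excess y             ∎
    where
    open ≡-Reasoning
    y a s r : ℕ
    y = x % n
    a = x / n
    s = y % m
    r = y / m

  -- m consecutive positions meet every column once: Σ (2s+1) = m².
  column-sum : ∀ p → sumTo (λ j → suc (((p + j) % m) * 2)) m ≡ m * m
  column-sum p = begin
    sumTo (λ j → suc (((p + j) % m) * 2)) m  ≡⟨ sumTo-periodic (λ j → suc ((j % m) * 2)) m (λ x → cong (λ z → suc (z * 2)) ([m+n]%n≡m%n x m)) p ⟩
    sumTo (λ j → suc ((j % m) * 2)) m        ≡⟨ sumTo-cong m (λ j j<m → cong (λ z → suc (z * 2)) (m<n⇒m%n≡m j<m)) ⟩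
    sumTo (λ j → suc (j * 2)) m              ≡⟨ sumTo-odd m ⟩
    m * m                                    ∎
    where open ≡-Reasoning

  -- A window of length k = 2m consists of the m pairs (y, y+m), so it sums to
  -- N·m² + (sum of m consecutive excesses), which telescopes to c up to the potentials.
  window-sum : ∀ p → W p k + potential ((p + m) % n) ≡ c + potential (p % n)
  window-sum p = begin
    W p k + pot′                                                               ≡⟨ cong (λ l → sumTo (λ j → P (p + j)) l + pot′) (trans (*-comm m 2) (cong (m +_) (+-identityʳ m))) ⟩
    sumTo (λ j → P (p + j)) (m + m) + pot′                                     ≡⟨ cong (_+ pot′) (sumTo-split (λ j → P (p + j)) m m) ⟩
    sumTo (λ j → P (p + j)) m + sumTo (λ j → P (p + (m + j))) m + pot′         ≡⟨ cong (λ x → sumTo (λ j → P (p + j)) m + x + pot′) (sumTo-cong m (λ j _ → cong P (shuffle j))) ⟨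
    sumTo (λ j → P (p + j)) m + sumTo (λ j → P (p + j + m)) m + pot′           ≡⟨ cong (_+ pot′) (sumTo-+ (λ j → P (p + j)) (λ j → P (p + j + m)) m) ⟨
    sumTo (λ j → P (p + j) + P (p + j + m)) m + pot′                           ≡⟨ cong (_+ pot′) (sumTo-cong m (λ j _ → pair (p + j))) ⟩
    sumTo (λ j → N * suc (((p + j) % m) * 2) + excess ((p + j) % n)) m + pot′  ≡⟨ cong (_+ pot′) (sumTo-+ _ _ m) ⟩
    sumTo (λ j → N * suc (((p + j) % m) * 2)) m + E + pot′                     ≡⟨ cong (λ x → x + E + pot′) (trans (sumTo-*ˡ N _ m) (cong (N *_) (column-sum p))) ⟩
    N * (m * m) + E + pot′                                                     ≡⟨ +-assoc (N * (m * m)) E pot′ ⟩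
    N * (m * m) + (E + pot′)                                                   ≡⟨ cong (N * (m * m) +_) (excess-sum p m) ⟩
    N * (m * m) + (m * 1 + potential (p % n))                                  ≡⟨ total N m (potential (p % n)) ⟩
    c + potential (p % n)                                                      ∎
    where
    open ≡-Reasoning
    pot′ E : ℕ
    pot′ = potential ((p + m) % n)
    E = sumTo (λ j → excess ((p + j) % n)) m
    shuffle : ∀ j → p + j + m ≡ p + (m + j)
    shuffle j = trans (+-assoc p j m) (cong (p +_) (+-comm j m))
    total : ∀ N m x → N * (m * m) + (m * 1 + x) ≡ m * suc (N * m) + x
    total = solve-∀

  -- Since both potentials lie in {0,1}, every window sum is within 1 of c.
  windows-above : ∀ (i : Fin n) → c ≤ suc (window σ k i)
  windows-above i = subst (λ w → c ≤ suc w) (sym (window≡W k i)) (begin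
    c                                  ≤⟨ m≤m+n c _ ⟩
    c + potential (p % n)              ≡⟨ window-sum p ⟨
    W p k + potential ((p + m) % n)    ≤⟨ +-monoʳ-≤ (W p k) (potential≤1 _) ⟩
    W p k + 1                          ≡⟨ +-comm (W p k) 1 ⟩
    suc (W p k)                        ∎)
    where
    open ≤-Reasoning
    p : ℕ
    p = toℕ i

  windows-below : ∀ (i : Fin n) → window σ k i ≤ suc c
  windows-below i = subst (_≤ suc c) (sym (window≡W k i)) (begin
    W p k                              ≤⟨ m≤m+n (W p k) _ ⟩
    W p k + potential ((p + m) % n)    ≡⟨ window-sum p ⟩
    c + potential (p % n)              ≤⟨ +-monoʳ-≤ c (potential≤1 _) ⟩
    c + 1                              ≡⟨ +-comm c 1 ⟩
    suc c                              ∎)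
    where
    open ≤-Reasoning
    p : ℕ
    p = toℕ i

MsumDisc : (n : ℕ) .{{_ : NonZero n}} → ℕ → Set
MsumDisc n k = MsumEq n k 1ℚ × (¬ (2 ∣ n) → DiscEq n k 1ℚ)

cast : ∀ {n n′ k k′} .{{_ : NonZero n}} .{{_ : NonZero n′}} → n ≡ n′ → k ≡ k′ → MsumDisc n′ k′ → MsumDisc n k
cast refl refl both = both

centre-integral : ∀ m n → m * 2 * suc n ≡ m * suc n * 2
centre-integral m n = trans (*-assoc m 2 (suc n)) (trans (cong (m *_) (*-comm 2 (suc n))) (sym (*-assoc m (suc n) 2)))

-- For even m the constructed n is even, so only the msum part is claimed.
even-case : ∀ q h → EvenCase.k q h < EvenCase.n q h → MsumDisc (EvenCase.n q h) (EvenCase.k q h)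
even-case q h k<n = msumEq σ windows-bounded , λ n-odd → ⊥-elim (n-odd (divides H refl))
  where
  open EvenCase q h
  open FromWindowBounds k c z<s k<n (centre-integral m n)

odd-case : ∀ q h → OddCase.k q h < OddCase.n q h → MsumDisc (OddCase.n q h) (OddCase.k q h)
odd-case q h k<n = msumEq σ windows-below , λ _ → discEq σ windows-above windows-below
  where
  open OddCase q h
  open FromWindowBounds k c z<s k<n (centre-integral m n)

-- n ≡ k/2 (mod k) with k = 2m means n = (2q+1)·m for q = ⌊n/k⌋.
odd-multiple : ∀ k m n .{{_ : NonZero k}} → k ≡ m * 2 → n % k ≡ k / 2 → n ≡ suc ((n / k) * 2) * m
odd-multiple k m n k≡2m n%k≡k/2 = begin
  n                            ≡⟨ m≡m%n+[m/n]*n n k ⟩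
  n % k + (n / k) * k          ≡⟨ cong₂ (λ x y → x + (n / k) * y) n%k≡m k≡2m ⟩
  m + (n / k) * (m * 2)        ≡⟨ regroup m (n / k) ⟩
  suc ((n / k) * 2) * m        ∎
  where
  open ≡-Reasoning
  n%k≡m : n % k ≡ m
  n%k≡m = trans n%k≡k/2 (trans (cong (_/ 2) k≡2m) (m*n/n≡m m 2))
  regroup : ∀ m q → m + q * (m * 2) ≡ suc (q * 2) * m
  regroup = solve-∀

corollary1p5 : (k : ℕ) .{{_ : NonZero k}} → 2 ∣ k →
    (n : ℕ) .{{_ : NonZero n}} → k < n → n % k ≡ k / 2 →
    MsumEq n k 1ℚ × (¬ (2 ∣ n) → DiscEq n k 1ℚ)
corollary1p5 k (divides m k≡2m) n k<n n%k≡k/2 = by-parity m (evenOdd m) k≡2m (odd-multiple k m n k≡2m n%k≡k/2)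
  where
  q : ℕ
  q = n / k
  by-parity : ∀ m → EvenOdd m → k ≡ m * 2 → n ≡ suc (q * 2) * m → MsumDisc n k
  by-parity .(0 * 2) (twice zero) k≡0 _ = ⊥-elim (≢-nonZero⁻¹ k k≡0)
  by-parity .(suc h * 2) (twice (suc h)) k≡2m n≡Nm = cast n≡ k≡2m (even-case q h (subst₂ _<_ k≡2m n≡ k<n))
    where
    n≡ : n ≡ EvenCase.n q h
    n≡ = trans n≡Nm (sym (*-assoc (suc (q * 2)) (suc h) 2))
  by-parity .(suc (h * 2)) (twice+1 h) k≡2m n≡Nm = cast n≡Nm k≡2m (odd-case q h (subst₂ _<_ k≡2m n≡Nm k<n))
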